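{- Let $g, k$ be positive integers, let $T$ be a tree with vertex weights $c : V(T) \to \mathbb{N}$, and let $V_1$ be the set of vertices $v$ of $T$ with $c(v) = 1$. Let $S$ be a subtree of $T$ with $c(S) > k$, let $l$ be a leaf of $S$ with $c(S - l) < k - g + 1$, let $M$ be a subset of $V(S) \setminus \{l\}$ and let $n$ be a vertex of $S - M - l$ such that $S - M$ is a tree, $n$ is a leaf of $S - M$, $c(S - M) > k$ and $c(S - M - n) < k - g + 1$. Then $$|M \cap V_1| \leq c(S) - (k + 1) \leq c(l) - g - 1.$$
   Context: $\mathbb{N} = \{1,2,3,\dots\}$. For a subgraph $H$ of $T$, $c(H) := \sum_{v \in V(H)} c(v)$. For a set or vertex $X$, $S - X$ denotes the subgraph obtained by deleting the vertices in $X$. -}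

module Defs where

open import Data.Nat using (ℕ; _≤_; _≡ᵇ_)
open import Data.Bool using (Bool; true; false; if_then_else_; T)
open import Data.Fin using (Fin)
open import Data.Fin.Subset using (Subset; _∈_; _∩_; ∣_∣)
open import Data.Vec using (tabulate; sum; lookup)
open import Data.List using (List; []; _∷_; _++_; [_]; length)
open import Data.List.Relation.Unary.All using (All)
open import Data.List.Relation.Unary.Linked using (Linked)
open import Data.List.Relation.Unary.Unique.Propositional using (Unique)
open import Data.Product using (Σ; _×_; ∃)
open import Relation.Binary.PropositionalEquality using (_≡_)
open import Relation.Nullary using (¬_)

record Graph (N : ℕ) : Set where
  field
    Adj    : Fin N → Fin N → Bool
    sym    : ∀ u v → Adj u v ≡ Adj v u
    irrefl : ∀ v → Adj v v ≡ false

module _ {N : ℕ} (G : Graph N) where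
  open Graph G

  Adjacent : Fin N → Fin N → Set
  Adjacent u v = T (Adj u v)

  data WalkIn (U : Subset N) : Fin N → Fin N → Set where
    here : ∀ {v} → v ∈ U → WalkIn U v v
    step : ∀ {u w v} → u ∈ U → Adjacent u w → WalkIn U w v → WalkIn U u v

  Connected : Subset N → Set
  Connected U = ∀ u v → u ∈ U → v ∈ U → WalkIn U u v

  -- A cycle in the induced subgraph on U: distinct vertices x, x₁, …, xₘ (m ≥ 2),
  -- consecutive ones adjacent, and xₘ adjacent to x.
  IsCycleIn : Subset N → Fin N → List (Fin N) → Set
  IsCycleIn U x xs =
    (2 ≤ length xs) × Unique (x ∷ xs) × All (_∈ U) (x ∷ xs)
      × Linked Adjacent (x ∷ xs ++ [ x ])

  Acyclic : Subset N → Set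
  Acyclic U = ∀ x xs → ¬ IsCycleIn U x xs

  IsTree : Subset N → Set
  IsTree U = (∃ λ v → v ∈ U) × Connected U × Acyclic U

  Nbhd : Fin N → Subset N
  Nbhd v = tabulate (Adj v)

  degIn : Subset N → Fin N → ℕ
  degIn U v = ∣ U ∩ Nbhd v ∣

  IsLeaf : Subset N → Fin N → Set
  IsLeaf U v = v ∈ U × degIn U v ≡ 1

weight : {N : ℕ} → (Fin N → ℕ) → Subset N → ℕ
weight c U = sum (tabulate λ i → if lookup U i then c i else 0)

V₁ : {N : ℕ} → (Fin N → ℕ) → Subset N
V₁ c = tabulate λ v → c v ≡ᵇ 1

-- As M ⊆ S and
-- every weight is at least 1, |M ∩ V₁| ≤ |M| ≤ c(M) = c(S) - c(S - M) ≤ c(S) - (k + 1).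
-- As l ∈ S, c(S) = c(S - l) + c(l) with c(S - l) ≤ k - g, so c(S) - (k + 1) ≤ c(l) - g - 1.
module Submission where

open import Defs
open import Data.Nat using (ℕ; _≤_)
open import Data.Integer using (ℤ; +_; _-_; _<_; _>_) renaming (_+_ to _+ℤ_; _≤_ to _≤ℤ_)
open import Data.Fin using (Fin)
open import Data.Fin.Subset using (Subset; ⊤; _∈_; _⊆_; _─_; _∩_; ⁅_⁆; ∣_∣)
open import Data.Product using (_×_)

open import Data.Bool using (true; false; if_then_else_)
open import Data.Fin using (zero; suc)
open import Data.Fin.Subset using (⊥)
open import Data.Fin.Subset.Properties using (drop-∷-⊆; p⊆q⇒∣p∣≤∣q∣; p∩q⊆p; p─q⊆p; x∈⁅y⁆⇒x≡y)
open import Data.Integer using (+≤+; +<+; -_; 1ℤ)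
import Data.Integer.Properties as ℤₚ
open import Data.Integer.Tactic.RingSolver using (solve-∀)
import Data.Nat as ℕ
open import Data.Nat using (_+_; z≤n)
import Data.Nat.Properties as ℕₚ
open import Data.Nat.Properties using (+-assoc; +-comm; +-identityʳ; +-mono-≤; +-commutativeSemigroup)
open import Algebra.Properties.CommutativeSemigroup +-commutativeSemigroup using (x∙yz≈y∙xz)
open import Data.Product using (_,_)
open import Data.Vec using ([]; _∷_; here)
open import Function using (_∘_)
open import Relation.Binary.PropositionalEquality
  using (_≡_; refl; sym; trans; cong; subst; module ≡-Reasoning)

private
  variable
    N : ℕ

weight-⊥ : (c : Fin N → ℕ) → weight c ⊥ ≡ 0
weight-⊥ {ℕ.zero}  c = refl
weight-⊥ {ℕ.suc N} c = weight-⊥ (c ∘ suc)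

weight-⁅⁆ : (c : Fin N → ℕ) (x : Fin N) → weight c ⁅ x ⁆ ≡ c x
weight-⁅⁆ c zero    = trans (cong (λ w → c zero + w) (weight-⊥ (c ∘ suc))) (+-identityʳ (c zero))
weight-⁅⁆ c (suc x) = weight-⁅⁆ (c ∘ suc) x

weight-─ : (c : Fin N → ℕ) (p q : Subset N) → q ⊆ p →
           weight c p ≡ weight c (p ─ q) + weight c q
weight-─ c []          []          _   = refl
weight-─ c (s ∷ p)     (false ∷ q) q⊆p
  rewrite weight-─ (c ∘ suc) p q (drop-∷-⊆ q⊆p) =
  sym (+-assoc (if s then c zero else 0) (weight (c ∘ suc) (p ─ q)) (weight (c ∘ suc) q))
weight-─ c (true ∷ p)  (true ∷ q)  q⊆p
  rewrite weight-─ (c ∘ suc) p q (drop-∷-⊆ q⊆p) =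
  x∙yz≈y∙xz (c zero) (weight (c ∘ suc) (p ─ q)) (weight (c ∘ suc) q)
weight-─ c (false ∷ p) (true ∷ q)  q⊆p with q⊆p here
... | ()

weight-─⁅⁆ : (c : Fin N → ℕ) {p : Subset N} {x : Fin N} → x ∈ p →
             weight c p ≡ weight c (p ─ ⁅ x ⁆) + c x
weight-─⁅⁆ c {p} {x} x∈p = begin
  weight c p                             ≡⟨ weight-─ c p ⁅ x ⁆ ⁅x⁆⊆p ⟩
  weight c (p ─ ⁅ x ⁆) + weight c ⁅ x ⁆  ≡⟨ cong (λ w → weight c (p ─ ⁅ x ⁆) + w) (weight-⁅⁆ c x) ⟩
  weight c (p ─ ⁅ x ⁆) + c x             ∎
  where
  open ≡-Reasoning

  ⁅x⁆⊆p : ⁅ x ⁆ ⊆ p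
  ⁅x⁆⊆p y∈⁅x⁆ = subst (_∈ p) (sym (x∈⁅y⁆⇒x≡y x y∈⁅x⁆)) x∈p

∣p∣≤weight : (c : Fin N → ℕ) → (∀ v → 1 ≤ c v) → (p : Subset N) → ∣ p ∣ ≤ weight c p
∣p∣≤weight c c≥1 []          = z≤n
∣p∣≤weight c c≥1 (false ∷ p) = ∣p∣≤weight (c ∘ suc) (c≥1 ∘ suc) p
∣p∣≤weight c c≥1 (true ∷ p)  = +-mono-≤ (c≥1 zero) (∣p∣≤weight (c ∘ suc) (c≥1 ∘ suc) p)

∣q∣+weight[p─q]≤weight[p] : (c : Fin N → ℕ) → (∀ v → 1 ≤ c v) → {p q : Subset N} → q ⊆ p →
                            ∣ q ∣ + weight c (p ─ q) ≤ weight c p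
∣q∣+weight[p─q]≤weight[p] c c≥1 {p} {q} q⊆p = begin
  ∣ q ∣ + weight c (p ─ q)         ≤⟨ ℕₚ.+-monoˡ-≤ (weight c (p ─ q)) (∣p∣≤weight c c≥1 q) ⟩
  weight c q + weight c (p ─ q)    ≡⟨ +-comm (weight c q) (weight c (p ─ q)) ⟩
  weight c (p ─ q) + weight c q    ≡⟨ sym (weight-─ c p q q⊆p) ⟩
  weight c p                       ∎
  where open ℕₚ.≤-Reasoning

[i+j]-j≡i : ∀ i j → i +ℤ j - j ≡ i
[i+j]-j≡i = solve-∀

i+j≤k⇒i≤k-j : ∀ {i j k} → i +ℤ j ≤ℤ k → i ≤ℤ k - j
i+j≤k⇒i≤k-j {i} {j} {k} i+j≤k = begin
  i             ≡⟨ sym ([i+j]-j≡i i j) ⟩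
  i +ℤ j - j    ≤⟨ ℤₚ.+-monoˡ-≤ (- j) i+j≤k ⟩
  k - j         ∎
  where open ℤₚ.≤-Reasoning

i<j-h+1⇒i+c-[j+1]≤c-h-1 : ∀ {i} c j h → i < (j - h) +ℤ 1ℤ →
                          (i +ℤ c) - (j +ℤ 1ℤ) ≤ℤ c - h - 1ℤ
i<j-h+1⇒i+c-[j+1]≤c-h-1 {i} c j h i<j-h+1 = begin
  (i +ℤ c) - (j +ℤ 1ℤ)                 ≡⟨ regroup i c j ⟩
  (1ℤ +ℤ i) +ℤ (c - j - 1ℤ - 1ℤ)       ≤⟨ ℤₚ.+-monoˡ-≤ (c - j - 1ℤ - 1ℤ) (ℤₚ.i<j⇒suc[i]≤j i<j-h+1) ⟩
  ((j - h) +ℤ 1ℤ) +ℤ (c - j - 1ℤ - 1ℤ) ≡⟨ cancel c j h ⟩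
  c - h - 1ℤ                           ∎
  where
  open ℤₚ.≤-Reasoning

  regroup : ∀ i c j → (i +ℤ c) - (j +ℤ 1ℤ) ≡ (1ℤ +ℤ i) +ℤ (c - j - 1ℤ - 1ℤ)
  regroup = solve-∀

  cancel : ∀ c j h → ((j - h) +ℤ 1ℤ) +ℤ (c - j - 1ℤ - 1ℤ) ≡ c - h - 1ℤ
  cancel = solve-∀

mainTheorem2 : (g k : ℕ) → 1 ≤ g → 1 ≤ k →
    {N : ℕ} (G : Graph N) → IsTree G ⊤ →
    (c : Fin N → ℕ) → (∀ v → 1 ≤ c v) →
    (S : Subset N) → IsTree G S → + weight c S > + k →
    (l : Fin N) → IsLeaf G S l →
    + weight c (S ─ ⁅ l ⁆) < (+ k - + g) +ℤ + 1 →
    (M : Subset N) → M ⊆ (S ─ ⁅ l ⁆) →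
    (n : Fin N) → n ∈ ((S ─ M) ─ ⁅ l ⁆) →
    IsTree G (S ─ M) → IsLeaf G (S ─ M) n → + weight c (S ─ M) > + k →
    + weight c ((S ─ M) ─ ⁅ n ⁆) < (+ k - + g) +ℤ + 1 →
    (+ ∣ M ∩ V₁ c ∣ ≤ℤ + weight c S - (+ k +ℤ + 1))
      × (+ weight c S - (+ k +ℤ + 1) ≤ℤ + c l - + g - + 1)
mainTheorem2 g k _ _ _ _ c c≥1 S _ _ l (l∈S , _) c[S─l]<k-g+1 M M⊆S─l _ _ _ _ (+<+ k<c[S─M]) _ =
  i+j≤k⇒i≤k-j {j = + (k + 1)} (+≤+ ∣M∩V₁∣+k+1≤c[S]) , c[S]-[k+1]≤c[l]-g-1
  where
  open ℕₚ.≤-Reasoning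

  ∣M∩V₁∣+k+1≤c[S] : ∣ M ∩ V₁ c ∣ + (k + 1) ≤ weight c S
  ∣M∩V₁∣+k+1≤c[S] = begin
    ∣ M ∩ V₁ c ∣ + (k + 1)   ≤⟨ +-mono-≤ (p⊆q⇒∣p∣≤∣q∣ (p∩q⊆p M (V₁ c))) k+1≤c[S─M] ⟩
    ∣ M ∣ + weight c (S ─ M) ≤⟨ ∣q∣+weight[p─q]≤weight[p] c c≥1 (p─q⊆p S ⁅ l ⁆ ∘ M⊆S─l) ⟩
    weight c S               ∎
    where
    k+1≤c[S─M] : k + 1 ≤ weight c (S ─ M)
    k+1≤c[S─M] = subst (_≤ weight c (S ─ M)) (+-comm 1 k) k<c[S─M]
  c[S]-[k+1]≤c[l]-g-1 : + weight c S - (+ k +ℤ + 1) ≤ℤ + c l - + g - + 1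
  c[S]-[k+1]≤c[l]-g-1 rewrite weight-─⁅⁆ c l∈S =
    i<j-h+1⇒i+c-[j+1]≤c-h-1 (+ c l) (+ k) (+ g) c[S─l]<k-g+1
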